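{- In each of the four sequent calculi $\mathbf{G3}_{\mathsf N}$, $\mathbf{G3}_{\mathsf{NeF}}$, $\mathbf{G3}_{\mathsf{CoPC}}$, $\mathbf{G3}_{\mathsf{MPC}}$, the contraction rule \[\frac{\Gamma,\alpha,\alpha\Rightarrow\varphi}{\Gamma,\alpha\Rightarrow\varphi}\] is height-preserving admissible: for all finite multisets $\Gamma$ and formulas $\alpha,\varphi$, if $\Gamma,\alpha,\alpha\Rightarrow\varphi$ has a derivation of height at most $n$, then $\Gamma,\alpha\Rightarrow\varphi$ has a derivation of height at most $n$ in the same calculus.
   Context: Formulas are built from a countable set of propositional variables $p,q,\dots$ and the constant $\top$ (there is no $\bot$) using binary $\land,\lor,\to$ and unary $\neg$. A sequent is $\Gamma\Rightarrow\varphi$ with $\Gamma$ a finite multiset of formulas and $\varphi$ a single formula; $\Gamma,\Delta$ denotes multiset union. The positive rules are: (ax) $\Gamma,p\Rightarrow p$ for a propositional variable $p$; ($\top$) $\Gamma\Rightarrow\top$; ($\to$r) from $\Gamma,\alpha\Rightarrow\beta$ infer $\Gamma\Rightarrow\alpha\to\beta$; ($\to$l) from $\Gamma,\alpha\to\beta\Rightarrow\alpha$ and $\Gamma,\beta\Rightarrow\varphi$ infer $\Gamma,\alpha\to\beta\Rightarrow\varphi$; ($\land$r) from $\Gamma\Rightarrow\alpha$ and $\Gamma\Rightarrow\beta$ infer $\Gamma\Rightarrow\alpha\land\beta$; ($\land$l) from $\Gamma,\alpha,\beta\Rightarrow\varphi$ infer $\Gamma,\alpha\land\beta\Rightarrow\varphi$;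 ($\lor$r$_1$), ($\lor$r$_2$) from $\Gamma\Rightarrow\alpha$ (resp. $\Gamma\Rightarrow\beta$) infer $\Gamma\Rightarrow\alpha\lor\beta$; ($\lor$l) from $\Gamma,\alpha\Rightarrow\varphi$ and $\Gamma,\beta\Rightarrow\varphi$ infer $\Gamma,\alpha\lor\beta\Rightarrow\varphi$. The negation rules are: (n) from $\Gamma,\neg\alpha,\beta\Rightarrow\alpha$ and $\Gamma,\neg\alpha,\alpha\Rightarrow\beta$ infer $\Gamma,\neg\alpha\Rightarrow\neg\beta$; (nef) from $\Gamma,\neg\alpha\Rightarrow\alpha$ infer $\Gamma,\neg\alpha\Rightarrow\neg\beta$; (copc) from $\Gamma,\neg\alpha,\beta\Rightarrow\alpha$ infer $\Gamma,\neg\alpha\Rightarrow\neg\beta$; (an) from $\Gamma,\alpha\Rightarrow\neg\alpha$ infer $\Gamma\Rightarrow\neg\alpha$. The calculi (without any structural rules) are: $\mathbf{G3}_{\mathsf N}$ = positive rules + (n); $\mathbf{G3}_{\mathsf{NeF}}$ = positive rules + (n) + (nef); $\mathbf{G3}_{\mathsf{CoPC}}$ = positive rules + (copc); $\mathbf{G3}_{\mathsf{MPC}}$ = positive rules + (copc) + (an). The height of a derivation is the number of inference steps along a longest branch of the derivation tree. -}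

module Defs where

open import Data.Nat using (ℕ; zero; suc; _⊔_; _≤_)
open import Data.List using (List; _∷_; [])
open import Data.Product using (Σ)
open import Data.List.Relation.Binary.Permutation.Propositional using (_↭_)

data Fm : Set where
  var  : ℕ → Fm
  ⊤'   : Fm
  _∧'_ : Fm → Fm → Fm
  _∨'_ : Fm → Fm → Fm
  _⇒_  : Fm → Fm → Fm
  ¬'_  : Fm → Fm

data Calc : Set where
  N NeF CoPC MPC : Calc

data HasN : Calc → Set where
  n-N   : HasN N
  n-NeF : HasN NeF

data HasNeF : Calc → Set where
  nef-NeF : HasNeF NeF

data HasCoPC : Calc → Set where
  copc-CoPC : HasCoPC CoPC
  copc-MPC  : HasCoPC MPC

data HasAN : Calc → Set where
  an-MPC : HasAN MPC

-- Antecedents are finite multisets, represented as lists up to permutation: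
-- every rule may be applied to any list Δ that is a permutation of the
-- displayed multiset (Δ ↭ Γ , α).  Γ , α  is written  α ∷ Γ.
data Der (c : Calc) : List Fm → Fm → Set where
  ax   : ∀ {Γ Δ} p → Δ ↭ (var p ∷ Γ) → Der c Δ (var p)
  top  : ∀ {Δ} → Der c Δ ⊤'
  impR : ∀ {Δ α β} → Der c (α ∷ Δ) β → Der c Δ (α ⇒ β)
  impL : ∀ {Γ Δ α β φ} → Δ ↭ ((α ⇒ β) ∷ Γ) →
         Der c ((α ⇒ β) ∷ Γ) α → Der c (β ∷ Γ) φ → Der c Δ φ
  andR : ∀ {Δ α β} → Der c Δ α → Der c Δ β → Der c Δ (α ∧' β)
  andL : ∀ {Γ Δ α β φ} → Δ ↭ ((α ∧' β) ∷ Γ) →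
         Der c (α ∷ β ∷ Γ) φ → Der c Δ φ
  orR₁ : ∀ {Δ α β} → Der c Δ α → Der c Δ (α ∨' β)
  orR₂ : ∀ {Δ α β} → Der c Δ β → Der c Δ (α ∨' β)
  orL  : ∀ {Γ Δ α β φ} → Δ ↭ ((α ∨' β) ∷ Γ) →
         Der c (α ∷ Γ) φ → Der c (β ∷ Γ) φ → Der c Δ φ
  negN : ∀ {Γ Δ α β} → HasN c → Δ ↭ ((¬' α) ∷ Γ) →
         Der c (β ∷ (¬' α) ∷ Γ) α → Der c (α ∷ (¬' α) ∷ Γ) β →
         Der c Δ (¬' β)
  nef  : ∀ {Γ Δ α β} → HasNeF c → Δ ↭ ((¬' α) ∷ Γ) →
         Der c ((¬' α) ∷ Γ) α → Der c Δ (¬' β)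
  copc : ∀ {Γ Δ α β} → HasCoPC c → Δ ↭ ((¬' α) ∷ Γ) →
         Der c (β ∷ (¬' α) ∷ Γ) α → Der c Δ (¬' β)
  an   : ∀ {Δ α} → HasAN c → Der c (α ∷ Δ) (¬' α) → Der c Δ (¬' α)

-- Height: number of inference steps along a longest branch
-- (an initial sequent (ax)/(⊤) counts as one step).
height : ∀ {c Δ φ} → Der c Δ φ → ℕ
height (ax _ _)         = 1
height top              = 1
height (impR d)         = suc (height d)
height (impL _ d e)     = suc (height d ⊔ height e)
height (andR d e)       = suc (height d ⊔ height e)
height (andL _ d)       = suc (height d)
height (orR₁ d)         = suc (height d)
height (orR₂ d)         = suc (height d)
height (orL _ d e)      = suc (height d ⊔ height e)
height (negN _ _ d e)   = suc (height d ⊔ height e)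
height (nef _ _ d)      = suc (height d)
height (copc _ _ d)     = suc (height d)
height (an _ d)         = suc (height d)

Der≤ : Calc → ℕ → List Fm → Fm → Set
Der≤ c n Δ φ = Σ (Der c Δ φ) (λ d → height d ≤ n)

module Submission where

-- Both contraction and the inversion of the left rules are instances of
-- one scheme: replacing a sub-multiset K of the antecedent by K'.  We show
-- once and for all (replace-step) that such a replacement is
-- height-preserving admissible at bound n+1 if it is so at bound n,
-- provided it keeps the propositional variables of K (for the axioms) and
-- the "principal cases" can be handled, i.e. the cases where the last
-- inference is a left rule whose principal formula lies in K.  All other
-- cases commute with the replacement.
--
-- To avoid height arithmetic, a derivation of height <= n+1 is unfolded
-- into its last inference with premises of height <= n (Step, view,
-- build).

open import Defs
open import Data.Nat using (ℕ; zero; suc; _⊔_; s≤s; z≤n)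
open import Data.Nat.Properties using (m≤n⇒m≤1+n; ⊔-lub; m⊔n≤o⇒m≤o; m⊔n≤o⇒n≤o)
open import Data.List using (List; _∷_; []; _++_)
open import Data.Product using (_,_)
open import Data.Sum using (inj₁; inj₂)
open import Data.Empty using (⊥; ⊥-elim)
open import Relation.Binary.PropositionalEquality using (refl)
open import Data.List.Relation.Unary.Any using (here; there)
open import Data.List.Membership.Propositional using (_∈_; _─_)
open import Data.List.Membership.Propositional.Properties using (∈-++⁺ˡ; ∈-++⁺ʳ; ∈-++⁻)
open import Data.List.Relation.Binary.Permutation.Propositional
  using (_↭_; ↭-refl; ↭-sym; ↭-trans; ↭-prep; ↭-swap)
open import Data.List.Relation.Binary.Permutation.Propositional.Properties
  using (∈-resp-↭; drop-∷; shift; shifts; ++⁺ˡ; ++⁺ʳ)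

private
  variable
    c : Calc
    n : ℕ
    Γ Γ₀ Δ Δ' K K' Ls R : List Fm
    α β φ P Q : Fm

∈⇒↭ : (m : Q ∈ Γ) → Γ ↭ Q ∷ (Γ ─ m)
∈⇒↭ (here refl) = ↭-refl
∈⇒↭ {Q = Q} {Γ = X ∷ _} (there m) = ↭-trans (↭-prep X (∈⇒↭ m)) (↭-swap X Q ↭-refl)

push : ∀ Xs → Γ₀ ↭ Q ∷ Γ → Xs ++ Γ₀ ↭ Q ∷ Xs ++ Γ
push {Q = Q} {Γ = Γ} Xs σ = ↭-trans (++⁺ˡ Xs σ) (shift Q Xs Γ)

data Position (Q : Fm) (K Γ₀ Γ : List Fm) : Set where
  inside  : (m : Q ∈ K) → Γ₀ ↭ (K ─ m) ++ Γ → Position Q K Γ₀ Γ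
  outside : ∀ R → Γ₀ ↭ K ++ R → Γ ↭ Q ∷ R → Position Q K Γ₀ Γ

locate : ∀ K → Q ∷ Γ₀ ↭ K ++ Γ → Position Q K Γ₀ Γ
locate {Q = Q} {Γ = Γ} K ρ with ∈-++⁻ K (∈-resp-↭ ρ (here refl))
... | inj₁ m = inside m (drop-∷ (↭-trans ρ (++⁺ʳ Γ (∈⇒↭ m))))
... | inj₂ m = outside (Γ ─ m) (drop-∷ (↭-trans ρ (push K (∈⇒↭ m)))) (∈⇒↭ m)

data LeftStep (c : Calc) (n : ℕ) : Fm → List Fm → Fm → Set where
  impL : Der≤ c n ((α ⇒ β) ∷ Γ₀) α → Der≤ c n (β ∷ Γ₀) φ → LeftStep c n (α ⇒ β) Γ₀ φ
  andL : Der≤ c n (α ∷ β ∷ Γ₀) φ → LeftStep c n (α ∧' β) Γ₀ φ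
  orL  : Der≤ c n (α ∷ Γ₀) φ → Der≤ c n (β ∷ Γ₀) φ → LeftStep c n (α ∨' β) Γ₀ φ
  negN : HasN c → Der≤ c n (β ∷ (¬' α) ∷ Γ₀) α → Der≤ c n (α ∷ (¬' α) ∷ Γ₀) β →
         LeftStep c n (¬' α) Γ₀ (¬' β)
  nef  : HasNeF c → Der≤ c n ((¬' α) ∷ Γ₀) α → LeftStep c n (¬' α) Γ₀ (¬' β)
  copc : HasCoPC c → Der≤ c n (β ∷ (¬' α) ∷ Γ₀) α → LeftStep c n (¬' α) Γ₀ (¬' β)

data Step (c : Calc) : ℕ → List Fm → Fm → Set where
  ax   : ∀ p → var p ∈ Δ → Step c (suc n) Δ (var p)
  top  : Step c (suc n) Δ ⊤'
  impR : Der≤ c n (α ∷ Δ) β → Step c (suc n) Δ (α ⇒ β)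
  andR : Der≤ c n Δ α → Der≤ c n Δ β → Step c (suc n) Δ (α ∧' β)
  orR₁ : Der≤ c n Δ α → Step c (suc n) Δ (α ∨' β)
  orR₂ : Der≤ c n Δ β → Step c (suc n) Δ (α ∨' β)
  an   : HasAN c → Der≤ c n (α ∷ Δ) (¬' α) → Step c (suc n) Δ (¬' α)
  left : Δ ↭ Q ∷ Γ₀ → LeftStep c n Q Γ₀ φ → Step c (suc n) Δ φ

view : Der≤ c n Δ φ → Step c n Δ φ
view (ax p ρ , s≤s _)          = ax p (∈-resp-↭ (↭-sym ρ) (here refl))
view (top , s≤s _)             = top
view (impR d , s≤s h)          = impR (d , h)
view (andR d e , s≤s h)        = andR (d , m⊔n≤o⇒m≤o _ _ h) (e , m⊔n≤o⇒n≤o _ _ h)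
view (orR₁ d , s≤s h)          = orR₁ (d , h)
view (orR₂ d , s≤s h)          = orR₂ (d , h)
view (an x d , s≤s h)          = an x (d , h)
view (impL ρ d e , s≤s h)      = left ρ (impL (d , m⊔n≤o⇒m≤o _ _ h) (e , m⊔n≤o⇒n≤o _ _ h))
view (andL ρ d , s≤s h)        = left ρ (andL (d , h))
view (orL ρ d e , s≤s h)       = left ρ (orL (d , m⊔n≤o⇒m≤o _ _ h) (e , m⊔n≤o⇒n≤o _ _ h))
view (negN x ρ d e , s≤s h)    = left ρ (negN x (d , m⊔n≤o⇒m≤o _ _ h) (e , m⊔n≤o⇒n≤o _ _ h))
view (nef x ρ d , s≤s h)       = left ρ (nef x (d , h))
view (copc x ρ d , s≤s h)      = left ρ (copc x (d , h))

build : Step c n Δ φ → Der≤ c n Δ φ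
build (ax p m)                 = ax p (∈⇒↭ m) , s≤s z≤n
build top                      = top , s≤s z≤n
build (impR (d , h))           = impR d , s≤s h
build (andR (d , h) (e , k))   = andR d e , s≤s (⊔-lub h k)
build (orR₁ (d , h))           = orR₁ d , s≤s h
build (orR₂ (d , h))           = orR₂ d , s≤s h
build (an x (d , h))           = an x d , s≤s h
build (left ρ (impL (d , h) (e , k)))   = impL ρ d e , s≤s (⊔-lub h k)
build (left ρ (andL (d , h)))           = andL ρ d , s≤s h
build (left ρ (orL (d , h) (e , k)))    = orL ρ d e , s≤s (⊔-lub h k)
build (left ρ (negN x (d , h) (e , k))) = negN x ρ d e , s≤s (⊔-lub h k)
build (left ρ (nef x (d , h)))          = nef x ρ d , s≤s h
build (left ρ (copc x (d , h)))         = copc x ρ d , s≤s h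

-- Every inference counts, so no derivation has height 0.
no-height-zero : Der≤ c 0 Δ φ → ⊥
no-height-zero d with view d
... | ()

raise : Der≤ c n Δ φ → Der≤ c (suc n) Δ φ
raise (d , h) = d , m≤n⇒m≤1+n h

exchange : Der≤ c n Δ φ → Δ ↭ Δ' → Der≤ c n Δ' φ
exchange {n = zero} d _ = ⊥-elim (no-height-zero d)
exchange {n = suc n} d π with view d
... | ax p m     = build (ax p (∈-resp-↭ π m))
... | top        = build top
... | impR d'    = build (impR (exchange d' (↭-prep _ π)))
... | andR d' e' = build (andR (exchange d' π) (exchange e' π))
... | orR₁ d'    = build (orR₁ (exchange d' π))
... | orR₂ d'    = build (orR₂ (exchange d' π))
... | an x d'    = build (an x (exchange d' (↭-prep _ π)))
... | left ρ s   = build (left (↭-trans (↭-sym π) ρ) s)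

record Replace (c : Calc) (n : ℕ) (K K' : List Fm) : Set where
  constructor replacing
  field replace : Der≤ c n Δ φ → Δ ↭ K ++ Γ → Der≤ c n (K' ++ Γ) φ
open Replace

under : Replace c n K K' → ∀ Xs → Der≤ c n (Xs ++ Δ) φ → Δ ↭ K ++ Γ →
        Der≤ c n (Xs ++ K' ++ Γ) φ
under {K = K} {K' = K'} r Xs d π =
  exchange (replace r d (↭-trans (++⁺ˡ Xs π) (shifts Xs K))) (shifts K' Xs)

-- A left inference whose side context contains K is unaffected by
-- replacing K, since every premise carries the side context.
beside : Replace c n K K' → LeftStep c n Q Γ₀ φ → Γ₀ ↭ K ++ R → LeftStep c n Q (K' ++ R) φ
beside r (impL d e)   σ = impL (under r (_ ∷ []) d σ) (under r (_ ∷ []) e σ)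
beside r (andL d)     σ = andL (under r (_ ∷ _ ∷ []) d σ)
beside r (orL d e)    σ = orL (under r (_ ∷ []) d σ) (under r (_ ∷ []) e σ)
beside r (negN x d e) σ = negN x (under r (_ ∷ _ ∷ []) d σ) (under r (_ ∷ _ ∷ []) e σ)
beside r (nef x d)    σ = nef x (under r (_ ∷ []) d σ)
beside r (copc x d)   σ = copc x (under r (_ ∷ _ ∷ []) d σ)

-- Axioms survive a replacement that keeps every variable of K.
VarsKept : List Fm → List Fm → Set
VarsKept K K' = ∀ {p} → var p ∈ K → var p ∈ K'

PrincipalCase : Calc → ℕ → List Fm → List Fm → Set
PrincipalCase c n K K' =
  ∀ {Q Γ₀ Γ φ} → LeftStep c n Q Γ₀ φ → (m : Q ∈ K) → Γ₀ ↭ (K ─ m) ++ Γ →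
  Der≤ c (suc n) (K' ++ Γ) φ

replace-step : Replace c n K K' → VarsKept K K' → PrincipalCase c n K K' →
               Step c (suc n) Δ φ → Δ ↭ K ++ Γ → Der≤ c (suc n) (K' ++ Γ) φ
replace-step {K = K} {K' = K'} r keep _ (ax p m) π with ∈-++⁻ K (∈-resp-↭ π m)
... | inj₁ inK = build (ax p (∈-++⁺ˡ (keep inK)))
... | inj₂ inΓ = build (ax p (∈-++⁺ʳ K' inΓ))
replace-step r _ _ top        π = build top
replace-step r _ _ (impR d)   π = build (impR (under r (_ ∷ []) d π))
replace-step r _ _ (andR d e) π = build (andR (replace r d π) (replace r e π))
replace-step r _ _ (orR₁ d)   π = build (orR₁ (replace r d π))
replace-step r _ _ (orR₂ d)   π = build (orR₂ (replace r d π))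
replace-step r _ _ (an x d)   π = build (an x (under r (_ ∷ []) d π))
replace-step {K = K} {K' = K'} r _ principal (left ρ s) π
  with locate K (↭-trans (↭-sym ρ) π)
... | inside m σ      = principal s m σ
... | outside R σ τ   = build (left (push K' τ) (beside r s σ))

-- P is replaced by the components Ls of one premise of its left rule.
data Invertible : Fm → List Fm → Set where
  inv-∧  : ∀ α β → Invertible (α ∧' β) (α ∷ β ∷ [])
  inv-∨₁ : ∀ α β → Invertible (α ∨' β) (α ∷ [])
  inv-∨₂ : ∀ α β → Invertible (α ∨' β) (β ∷ [])
  inv-⇒  : ∀ α β → Invertible (α ⇒ β) (β ∷ [])

-- An invertible formula is compound, so no axiom uses it.
invertible-keeps-vars : Invertible P Ls → VarsKept (P ∷ []) Ls
invertible-keeps-vars (inv-∧ _ _)  (here ())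
invertible-keeps-vars (inv-∨₁ _ _) (here ())
invertible-keeps-vars (inv-∨₂ _ _) (here ())
invertible-keeps-vars (inv-⇒ _ _)  (here ())
invertible-keeps-vars _ (there ())

-- When P is principal, the required premise is already a derivation.
invert-principal : Invertible P Ls → PrincipalCase c n (P ∷ []) Ls
invert-principal (inv-∧ α β)  (andL d)   (here refl) σ = raise (exchange d (↭-prep α (↭-prep β σ)))
invert-principal (inv-∨₁ α β) (orL d _)  (here refl) σ = raise (exchange d (↭-prep α σ))
invert-principal (inv-∨₂ α β) (orL _ e)  (here refl) σ = raise (exchange e (↭-prep β σ))
invert-principal (inv-⇒ α β)  (impL _ e) (here refl) σ = raise (exchange e (↭-prep β σ))
invert-principal _ _ (there ()) _

invert : Invertible P Ls → ∀ n → Replace c n (P ∷ []) Ls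
invert i zero    = replacing λ d _ → ⊥-elim (no-height-zero d)
invert i (suc n) = replacing λ d π →
  replace-step (invert i n) (invertible-keeps-vars i) (invert-principal i) (view d) π

Contraction : Calc → ℕ → Set
Contraction c n = ∀ {α} → Replace c n (α ∷ α ∷ []) (α ∷ [])

contraction-keeps-vars : VarsKept (α ∷ α ∷ []) (α ∷ [])
contraction-keeps-vars (here refl)         = here refl
contraction-keeps-vars (there (here refl)) = here refl
contraction-keeps-vars (there (there ()))

-- A premise holding a component Q of P next to a copy of P: inverting P
-- produces a second copy of Q, which is then contracted.
invert-then-contract : Contraction c n → Invertible P (Q ∷ []) → Der≤ c n (Q ∷ Γ₀) φ →
                       Γ₀ ↭ P ∷ Γ → Der≤ c n (Q ∷ Γ) φ
invert-then-contract {Q = Q} ih i d σ =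
  replace ih (replace (invert i _) d (push (Q ∷ []) σ)) ↭-refl

-- A left inference with principal formula α whose side context still
-- contains α: invert the copy of α and contract the resulting components
-- (or, for the negation rules, contract ¬α directly) in the premises.
contract-left : Contraction c n → LeftStep c n α Γ₀ φ → Γ₀ ↭ α ∷ Γ →
                Der≤ c (suc n) (α ∷ Γ) φ
contract-left ih (impL {α = α} {β = β} d e) σ =
  build (left ↭-refl (impL (replace ih d (↭-prep _ σ))
                           (invert-then-contract ih (inv-⇒ α β) e σ)))
contract-left {c = c} {n = n} {φ = φ} {Γ = Γ} ih (andL {α = α} {β = β} d) σ =
  build (left ↭-refl (andL (under ih (α ∷ []) contractedα ↭-refl)))
  where
  inverted : Der≤ c n (α ∷ β ∷ α ∷ β ∷ Γ) φ
  inverted = replace (invert (inv-∧ α β) n) d (push (α ∷ β ∷ []) σ)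
  contractedα : Der≤ c n (α ∷ β ∷ β ∷ Γ) φ
  contractedα = replace ih inverted (↭-prep α (↭-swap β α ↭-refl))
contract-left ih (orL {α = α} {β = β} d e) σ =
  build (left ↭-refl (orL (invert-then-contract ih (inv-∨₁ α β) d σ)
                          (invert-then-contract ih (inv-∨₂ α β) e σ)))
contract-left ih (negN {β = β} {α = α} x d e) σ =
  build (left ↭-refl (negN x (under ih (β ∷ []) d (↭-prep _ σ))
                             (under ih (α ∷ []) e (↭-prep _ σ))))
contract-left ih (nef x d) σ = build (left ↭-refl (nef x (replace ih d (↭-prep _ σ))))
contract-left ih (copc {β = β} {α = α} x d) σ =
  build (left ↭-refl (copc x (under ih (β ∷ []) d (↭-prep _ σ))))

contract-principal : Contraction c n → PrincipalCase c n (α ∷ α ∷ []) (α ∷ [])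
contract-principal ih s (here refl)         σ = contract-left ih s σ
contract-principal ih s (there (here refl)) σ = contract-left ih s σ
contract-principal ih s (there (there ()))  σ

contract : ∀ n → Contraction c n
contract zero    = replacing λ d _ → ⊥-elim (no-height-zero d)
contract (suc n) = replacing λ d π →
  replace-step (contract n) contraction-keeps-vars (contract-principal (contract n)) (view d) π

proposition3p2 : (c : Calc) (n : ℕ) (Γ : List Fm) (α φ : Fm) →
    Der≤ c n (α ∷ α ∷ Γ) φ → Der≤ c n (α ∷ Γ) φ
proposition3p2 c n Γ α φ d = replace (contract n) d ↭-refl
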